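{- For every integer $n>0$, the number of distinct frames of Dyck paths of length $2n$ is $2^{n-1}$.
   Context: A Dyck path of length $2n$ is a lattice path from $(0,0)$ to $(2n,0)$ with steps $(1,1)$, $(1,-1)$ never going below the $x$-axis. The frame of a Dyck path is the eventually zero sequence $(i_0,i_1,\ldots)$ where $i_k$ is the number of vertices of the path (including endpoints) at height $k$. -}

module Defs where

open import Data.Nat using (ℕ; zero; suc; pred; _≡ᵇ_; _*_)
open import Data.List using (List; []; _∷_; length; filter)
open import Data.Vec using (Vec; tabulate)
open import Data.Fin using (Fin; toℕ)
open import Data.Bool using (T)
open import Relation.Nullary.Decidable using (T?)
open import Data.Product using (∃; _×_)
open import Relation.Binary.PropositionalEquality using (_≡_)

-- steps of a lattice path: U = (1,1), D = (1,-1)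
data Step : Set where
  U D : Step

-- DyckFrom h s : the path s started at height h never goes below the
-- x-axis and ends at height 0.
data DyckFrom : ℕ → List Step → Set where
  end  : DyckFrom 0 []
  up   : ∀ {h s} → DyckFrom (suc h) s → DyckFrom h (U ∷ s)
  down : ∀ {h s} → DyckFrom h s → DyckFrom (suc h) (D ∷ s)

IsDyckPath : ℕ → List Step → Set
IsDyckPath n s = (length s ≡ 2 * n) × DyckFrom 0 s

heights : ℕ → List Step → List ℕ
heights h []      = h ∷ []
heights h (U ∷ s) = h ∷ heights (suc h) s
heights h (D ∷ s) = h ∷ heights (pred h) s

vertsAt : List Step → ℕ → ℕ
vertsAt s k = length (filter (λ x → T? (k ≡ᵇ x)) (heights 0 s))

-- the frame (i_0, ..., i_n) of a path of length 2n; all further entries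
-- i_k (k > n) are zero for a Dyck path of length 2n, since its height is at most n
frame : (n : ℕ) → List Step → Vec ℕ (suc n)
frame n s = tabulate (λ (k : Fin (suc n)) → vertsAt s (toℕ k))

IsFrame : (n : ℕ) → Vec ℕ (suc n) → Set
IsFrame n f = ∃ λ s → IsDyckPath n s × frame n s ≡ f

module Submission where

-- Frames of Dyck paths of semilength n = m + 1 are counted by exhibiting an
-- explicit duplicate-free list `frames m` of 2^m vectors whose members are
-- exactly those frames.  The list is generated by
--   frames 0       = [ (2,1) ]
--   frames (m + 1) = [ 2 ∷ f | f ∈ frames m ] ++ [ bump f | f ∈ frames m ],
-- where `bump` adds one vertex at height 0 and one at height 1.  These two
-- operations on frames are the traces of two operations on Dyck paths:
--   lifting  p ↦ U p D   turns the frame f of p into 2 ∷ f, and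
--   a peak   t ↦ U D t   turns the frame f of t into bump f.  For completeness a Dyck path of
-- semilength at least 2 is cut at its first return to the axis: it is either
-- a lift U p D, or of the form U p D U r D q, whose vertex counts exceed those
-- of the shorter Dyck path U p r D q by exactly one peak.  The list has no
-- duplicates because its first half consists of frames with i₀ = 2 and its
-- second half of frames with i₀ ≥ 3.

open import Defs
open import Data.Nat using (ℕ; zero; suc; pred; _+_; _*_; _^_; _∸_; _≤_; _<_; _≡ᵇ_; z≤n; s≤s; _<?_)
open import Data.Nat.Properties
open import Data.List using (List; []; _∷_; _++_; length; map; filter)
open import Data.List.Properties using (length-++; length-map; filter-++; filter-reject; ++-identityʳ)
open import Data.List.Relation.Unary.All as All using (All; []; _∷_)
open import Data.List.Relation.Unary.Any using (here)
open import Data.List.Relation.Unary.AllPairs using ([]; _∷_)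
open import Data.List.Relation.Unary.Unique.Propositional using (Unique)
open import Data.List.Relation.Unary.Unique.Propositional.Properties using (++⁺; map⁺)
open import Data.List.Relation.Binary.Disjoint.Propositional using (Disjoint)
open import Data.List.Membership.Propositional using (_∈_)
open import Data.List.Membership.Propositional.Properties using (∈-++⁻; ∈-++⁺ˡ; ∈-++⁺ʳ; ∈-map⁻; ∈-map⁺)
open import Data.Vec using (Vec; []; _∷_; tabulate; head)
open import Data.Vec.Properties using (tabulate-cong; ∷-injectiveʳ)
open import Data.Fin using (toℕ)
open import Data.Bool using (true; false)
open import Data.Sum using (_⊎_; inj₁; inj₂)
open import Data.Product using (∃; ∃₂; _×_; _,_)
open import Function.Base using (_∘_)
open import Function.Bundles using (_⇔_; mk⇔)
open import Relation.Nullary using (yes; no)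
open import Relation.Nullary.Decidable using (T?)
open import Relation.Binary.PropositionalEquality
  using (_≡_; _≢_; refl; sym; trans; cong; cong₂; subst; module ≡-Reasoning)

-- Counting occurrences.  `occ k xs` is the number of occurrences of k in xs,
-- written exactly as in `vertsAt`, so that vertsAt s k = occ k (heights 0 s).

occ : ℕ → List ℕ → ℕ
occ k xs = length (filter (λ x → T? (k ≡ᵇ x)) xs)

occ-++ : ∀ k xs ys → occ k (xs ++ ys) ≡ occ k xs + occ k ys
occ-++ k xs ys =
  trans (cong length (filter-++ (λ x → T? (k ≡ᵇ x)) xs ys)) (length-++ (filter _ xs))

occ-∷ : ∀ k x xs → occ k (x ∷ xs) ≡ occ k (x ∷ []) + occ k xs
occ-∷ k x = occ-++ k (x ∷ [])

length-insert : ∀ {A : Set} (xs zs ys : List A) →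
  length (xs ++ zs ++ ys) ≡ length zs + length (xs ++ ys)
length-insert []       zs ys = length-++ zs
length-insert (x ∷ xs) zs ys =
  trans (cong suc (length-insert xs zs ys)) (sym (+-suc (length zs) _))

occ-insert : ∀ k xs zs ys → occ k (xs ++ zs ++ ys) ≡ occ k zs + occ k (xs ++ ys)
occ-insert k xs zs ys = begin
  length (filter P? (xs ++ zs ++ ys))
    ≡⟨ cong length (filter-++ P? xs (zs ++ ys)) ⟩
  length (filter P? xs ++ filter P? (zs ++ ys))
    ≡⟨ cong (λ l → length (filter P? xs ++ l)) (filter-++ P? zs ys) ⟩
  length (filter P? xs ++ filter P? zs ++ filter P? ys)
    ≡⟨ length-insert (filter P? xs) (filter P? zs) (filter P? ys) ⟩
  occ k zs + length (filter P? xs ++ filter P? ys)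
    ≡⟨ cong (λ l → occ k zs + length l) (sym (filter-++ P? xs ys)) ⟩
  occ k zs + occ k (xs ++ ys) ∎
  where
  open ≡-Reasoning
  P? = λ x → T? (k ≡ᵇ x)

occ-other : ∀ {k x} → k ≢ x → occ k (x ∷ []) ≡ 0
occ-other {k} {x} k≢x = cong length (filter-reject (λ y → T? (k ≡ᵇ y)) (k≢x ∘ ≡ᵇ⇒≡ k x))

occ-suc : ∀ k x → occ (suc k) (suc x ∷ []) ≡ occ k (x ∷ [])
occ-suc k x with k ≡ᵇ x
... | false = refl
... | true  = refl

occ-map-suc : ∀ k xs → occ (suc k) (map suc xs) ≡ occ k xs
occ-map-suc k []       = refl
occ-map-suc k (x ∷ xs) = begin
  occ (suc k) (suc x ∷ map suc xs)          ≡⟨ occ-∷ (suc k) (suc x) (map suc xs) ⟩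
  occ (suc k) (suc x ∷ []) + occ (suc k) (map suc xs)
                                            ≡⟨ cong₂ _+_ (occ-suc k x) (occ-map-suc k xs) ⟩
  occ k (x ∷ []) + occ k xs                 ≡⟨ sym (occ-∷ k x xs) ⟩
  occ k (x ∷ xs)                            ∎
  where open ≡-Reasoning

occ-zero-map-suc : ∀ xs → occ 0 (map suc xs) ≡ 0
occ-zero-map-suc []       = refl
occ-zero-map-suc (x ∷ xs) = trans (occ-∷ 0 (suc x) (map suc xs)) (occ-zero-map-suc xs)

occ-above : ∀ k xs → All (_< k) xs → occ k xs ≡ 0
occ-above k []       []           = refl
occ-above k (x ∷ xs) (x<k ∷ xs<k) = trans (occ-∷ k x xs)
  (cong₂ _+_ (occ-other (λ k≡x → <-irrefl (sym k≡x) x<k)) (occ-above k xs xs<k))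

heights⁻ : ℕ → List Step → List ℕ
heights⁻ h []      = []
heights⁻ h (U ∷ s) = h ∷ heights⁻ (suc h) s
heights⁻ h (D ∷ s) = h ∷ heights⁻ (pred h) s

heights-++ : ∀ {h p} → DyckFrom h p → ∀ y → heights h (p ++ y) ≡ heights⁻ h p ++ heights 0 y
heights-++ end      y = refl
heights-++ (up d)   y = cong (_ ∷_) (heights-++ d y)
heights-++ (down d) y = cong (_ ∷_) (heights-++ d y)

heights-++-raised : ∀ {h p} → DyckFrom h p → ∀ y →
  heights (suc h) (p ++ y) ≡ map suc (heights⁻ h p) ++ heights 1 y
heights-++-raised end      y = refl
heights-++-raised (up d)   y = cong (_ ∷_) (heights-++-raised d y)
heights-++-raised (down d) y = cong (_ ∷_) (heights-++-raised d y)

heights-dyck : ∀ {p} → DyckFrom 0 p → heights 0 p ≡ heights⁻ 0 p ++ 0 ∷ []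
heights-dyck {p} d = trans (cong (heights 0) (sym (++-identityʳ p))) (heights-++ d [])

dyck-++ : ∀ {h j p q} → DyckFrom h p → DyckFrom j q → DyckFrom (h + j) (p ++ q)
dyck-++ end      e = e
dyck-++ (up d)   e = up (dyck-++ d e)
dyck-++ (down d) e = down (dyck-++ d e)

-- First passage: a path from height j + h + 1 to the axis first reaches height h
-- by a down step, after a part p that (relative to level h + 1) goes from j to 0.
first-passage : ∀ j h {s} → DyckFrom (j + suc h) s →
  ∃₂ λ p q → DyckFrom j p × DyckFrom h q × s ≡ p ++ D ∷ q
first-passage zero    h (up d) with first-passage 1 h d
... | p , q , dp , dq , refl = U ∷ p , q , up dp , dq , refl
first-passage (suc j) h (up d) with first-passage (suc (suc j)) h d
... | p , q , dp , dq , refl = U ∷ p , q , up dp , dq , refl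
first-passage zero    h (down d) = [] , _ , end , d , refl
first-passage (suc j) h (down d) with first-passage j h d
... | p , q , dp , dq , refl = D ∷ p , q , down dp , dq , refl

-- Cutting a Dyck path U s at its first return to the axis: with p, r, q Dyck
-- paths, either U s = U p D is a lift, or U s = U p D U r D q.
data FirstReturn : List Step → Set where
  lifted   : ∀ {p} → DyckFrom 0 p → FirstReturn (p ++ D ∷ [])
  continued : ∀ {p r q} → DyckFrom 0 p → DyckFrom 0 r → DyckFrom 0 q →
             FirstReturn (p ++ D ∷ U ∷ r ++ D ∷ q)

first-return : ∀ {s} → DyckFrom 1 s → FirstReturn s
first-return d with first-passage 0 0 d
... | p , [] , dp , end , refl = lifted dp
... | p , U ∷ _ , dp , up dq , refl with first-passage 0 0 dq
...   | r , q , dr , dq′ , refl = continued dp dr dq′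

-- Height bound: a path from height h to the axis of length ℓ stays at most
-- at height (h + ℓ) / 2, since it must still descend to 0.
start≤length : ∀ {h s} → DyckFrom h s → h ≤ length s
start≤length end      = z≤n
start≤length (up d)   = ≤-trans (n≤1+n _) (≤-trans (start≤length d) (n≤1+n _))
start≤length (down d) = s≤s (start≤length d)

start-bound : ∀ {h s} → DyckFrom h s → 2 * h ≤ h + length s
start-bound {h} {s} d =
  subst (_≤ h + length s) (cong (h +_) (sym (+-identityʳ h))) (+-monoʳ-≤ h (start≤length d))

heights-bound : ∀ {h s} → DyckFrom h s → All (λ x → 2 * x ≤ h + length s) (heights h s)
heights-bound end = z≤n ∷ []
heights-bound {h} (up {s = s} d) = start-bound (up d) ∷
  All.map (λ b → ≤-trans b (≤-reflexive (sym (+-suc h (length s))))) (heights-bound d)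
heights-bound {suc h} (down {s = s} d) = start-bound (down d) ∷
  All.map (λ b → ≤-trans b (+-mono-≤ (n≤1+n h) (n≤1+n (length s)))) (heights-bound d)

vertsAt-above : ∀ {n t} → IsDyckPath n t → ∀ {k} → n < k → vertsAt t k ≡ 0
vertsAt-above {n} {t} (len , d) {k} n<k = occ-above k _ (All.map below (heights-bound d))
  where
  below : ∀ {x} → 2 * x ≤ length t → x < k
  below b = ≤-<-trans (*-cancelˡ-≤ 2 (subst (_ ≤_) len b)) n<k

entry : ∀ {m} → Vec ℕ m → ℕ → ℕ
entry []      i       = 0
entry (x ∷ v) zero    = x
entry (x ∷ v) (suc i) = entry v i

entry-tabulate-< : ∀ m (g : ℕ → ℕ) {i} → i < m →
  entry (tabulate {n = m} (λ k → g (toℕ k))) i ≡ g i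
entry-tabulate-< (suc m) g {zero}  _         = refl
entry-tabulate-< (suc m) g {suc i} (s≤s i<m) = entry-tabulate-< m (λ k → g (suc k)) i<m

entry-tabulate-≥ : ∀ m (g : ℕ → ℕ) {i} → m ≤ i →
  entry (tabulate {n = m} (λ k → g (toℕ k))) i ≡ 0
entry-tabulate-≥ zero    g _         = refl
entry-tabulate-≥ (suc m) g (s≤s m≤i) = entry-tabulate-≥ m (λ k → g (suc k)) m≤i

entry-injective : ∀ {m} (v w : Vec ℕ m) → (∀ {i} → i < m → entry v i ≡ entry w i) → v ≡ w
entry-injective []      []      _  = refl
entry-injective (x ∷ v) (y ∷ w) eq =
  cong₂ _∷_ (eq (s≤s z≤n)) (entry-injective v w (λ i<m → eq (s≤s i<m)))

entry-frame : ∀ {n t} → IsDyckPath n t → ∀ k → entry (frame n t) k ≡ vertsAt t k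
entry-frame {n} {t} dyck k with k <? suc n
... | yes k≤n = entry-tabulate-< (suc n) (vertsAt t) k≤n
... | no  k>n = trans (entry-tabulate-≥ (suc n) (vertsAt t) (≮⇒≥ k>n))
                      (sym (vertsAt-above dyck (≮⇒≥ k>n)))

-- `peak k`: vertex count at height k of a peak U D, not counting its last vertex.
peak : ℕ → ℕ
peak k = occ k (0 ∷ 1 ∷ [])

peak-swap : ∀ k → occ k (1 ∷ 0 ∷ []) ≡ peak k
peak-swap 0             = refl
peak-swap 1             = refl
peak-swap (suc (suc k)) = refl

-- The last two vertices 1, 0 of a lift U p D count at height k + 1 as the
-- last vertex 0 of p counts at height k.
lift-end : ∀ k → occ (suc k) (1 ∷ 0 ∷ []) ≡ occ k (0 ∷ [])
lift-end zero    = refl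
lift-end (suc k) = refl

-- The frame f with one more vertex at heights 0 and 1 (one entry longer,
-- since the maximal height may have grown).
bump : ∀ {n} → Vec ℕ (suc n) → Vec ℕ (suc (suc n))
bump f = tabulate (λ k → peak (toℕ k) + entry f (toℕ k))

bump-injective : ∀ {n} {f g : Vec ℕ (suc n)} → bump f ≡ bump g → f ≡ g
bump-injective {n} {f} {g} eq = entry-injective f g λ {i} i<n →
  +-cancelˡ-≡ (peak i) _ _ (begin
    peak i + entry f i ≡⟨ sym (entry-tabulate-< (2 + n) (λ k → peak k + entry f k) (m<n⇒m<1+n i<n)) ⟩
    entry (bump f) i   ≡⟨ cong (λ v → entry v i) eq ⟩
    entry (bump g) i   ≡⟨ entry-tabulate-< (2 + n) (λ k → peak k + entry g k) (m<n⇒m<1+n i<n) ⟩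
    peak i + entry g i ∎)
  where open ≡-Reasoning

head-bump : ∀ {n} (f : Vec ℕ (suc n)) → head (bump f) ≡ suc (head f)
head-bump (x ∷ f) = refl

vertsAt-peak : ∀ t k → vertsAt (U ∷ D ∷ t) k ≡ peak k + vertsAt t k
vertsAt-peak t k = occ-++ k (0 ∷ 1 ∷ []) (heights 0 t)

-- Contracting the factor D U at height 0 in U p D U r D q to get U p r D q
-- removes one vertex at height 1 and one at height 0, i.e. one peak.
vertsAt-merge : ∀ {p} r q → DyckFrom 0 p → ∀ k →
  vertsAt (U ∷ p ++ D ∷ U ∷ r ++ D ∷ q) k ≡ peak k + vertsAt (U ∷ p ++ r ++ D ∷ q) k
vertsAt-merge {p} r q dp k = begin
  occ k (heights 0 (U ∷ p ++ D ∷ U ∷ rDq))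
    ≡⟨ cong (λ hs → occ k (0 ∷ hs)) (heights-++-raised dp (D ∷ U ∷ rDq)) ⟩
  occ k ((0 ∷ A) ++ (1 ∷ 0 ∷ []) ++ heights 1 rDq)
    ≡⟨ occ-insert k (0 ∷ A) (1 ∷ 0 ∷ []) (heights 1 rDq) ⟩
  occ k (1 ∷ 0 ∷ []) + occ k (0 ∷ A ++ heights 1 rDq)
    ≡⟨ cong₂ _+_ (peak-swap k) (cong (λ hs → occ k (0 ∷ hs)) (sym (heights-++-raised dp rDq))) ⟩
  peak k + occ k (heights 0 (U ∷ p ++ rDq)) ∎
  where
  open ≡-Reasoning
  rDq = r ++ D ∷ q
  A   = map suc (heights⁻ 0 p)

frame-bump : ∀ {n t} s → IsDyckPath n t → (∀ k → vertsAt s k ≡ peak k + vertsAt t k) →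
  frame (suc n) s ≡ bump (frame n t)
frame-bump {n} s dyck extra = tabulate-cong λ i →
  trans (extra (toℕ i)) (cong (peak (toℕ i) +_) (sym (entry-frame {n} dyck (toℕ i))))

frame-lift : ∀ n {p} → DyckFrom 0 p → frame (suc n) (U ∷ p ++ D ∷ []) ≡ 2 ∷ frame n p
frame-lift n {p} dp = cong₂ _∷_ at-zero (tabulate-cong λ i → above-zero (toℕ i))
  where
  open ≡-Reasoning
  A = heights⁻ 0 p
  lifted-heights : heights 0 (U ∷ p ++ D ∷ []) ≡ 0 ∷ map suc A ++ 1 ∷ 0 ∷ []
  lifted-heights = cong (0 ∷_) (heights-++-raised dp (D ∷ []))
  at-zero : vertsAt (U ∷ p ++ D ∷ []) 0 ≡ 2
  at-zero = begin
    occ 0 (heights 0 (U ∷ p ++ D ∷ []))    ≡⟨ cong (occ 0) lifted-heights ⟩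
    suc (occ 0 (map suc A ++ 1 ∷ 0 ∷ []))  ≡⟨ cong suc (occ-++ 0 (map suc A) (1 ∷ 0 ∷ [])) ⟩
    suc (occ 0 (map suc A) + 1)            ≡⟨ cong (λ c → suc (c + 1)) (occ-zero-map-suc A) ⟩
    2                                      ∎
  above-zero : ∀ k → vertsAt (U ∷ p ++ D ∷ []) (suc k) ≡ vertsAt p k
  above-zero k = begin
    occ (suc k) (heights 0 (U ∷ p ++ D ∷ []))          ≡⟨ cong (occ (suc k)) lifted-heights ⟩
    occ (suc k) (map suc A ++ 1 ∷ 0 ∷ [])              ≡⟨ occ-++ (suc k) (map suc A) (1 ∷ 0 ∷ []) ⟩
    occ (suc k) (map suc A) + occ (suc k) (1 ∷ 0 ∷ []) ≡⟨ cong₂ _+_ (occ-map-suc k A) (lift-end k) ⟩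
    occ k A + occ k (0 ∷ [])                           ≡⟨ sym (occ-++ k A (0 ∷ [])) ⟩
    occ k (A ++ 0 ∷ [])                                ≡⟨ cong (occ k) (sym (heights-dyck dp)) ⟩
    vertsAt p k                                        ∎

semilength-up : ∀ {ℓ} n → ℓ ≡ 2 * n → 2 + ℓ ≡ 2 * suc n
semilength-up n eq = trans (cong (2 +_) eq) (sym (*-suc 2 n))

semilength-down : ∀ {ℓ} n → 2 + ℓ ≡ 2 * suc n → ℓ ≡ 2 * n
semilength-down n eq = suc-injective (suc-injective (trans eq (*-suc 2 n)))

length-lift : ∀ p → length (U ∷ p ++ D ∷ []) ≡ 2 + length p
length-lift p = cong suc (trans (length-++ p) (+-comm (length p) 1))

length-merge : ∀ p r q →
  length (U ∷ p ++ D ∷ U ∷ r ++ D ∷ q) ≡ 2 + length (U ∷ p ++ r ++ D ∷ q)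
length-merge p r q = cong suc (length-insert p (D ∷ U ∷ []) (r ++ D ∷ q))

lift-dyck : ∀ {n p} → IsDyckPath n p → IsDyckPath (suc n) (U ∷ p ++ D ∷ [])
lift-dyck {n} {p} (len , d) =
  trans (length-lift p) (semilength-up n len) , up (dyck-++ d (down end))

peak-dyck : ∀ {n t} → IsDyckPath n t → IsDyckPath (suc n) (U ∷ D ∷ t)
peak-dyck {n} (len , d) = semilength-up n len , up (down d)

-- The list of frames of Dyck paths of length 2 (m + 1).

frames : (m : ℕ) → List (Vec ℕ (suc (suc m)))
frames zero    = (2 ∷ 1 ∷ []) ∷ []
frames (suc m) = map (2 ∷_) (frames m) ++ map bump (frames m)

∈-frames⁻ : ∀ {m f} → f ∈ frames (suc m) →
  (∃ λ g → g ∈ frames m × f ≡ 2 ∷ g) ⊎ (∃ λ g → g ∈ frames m × f ≡ bump g)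
∈-frames⁻ {m} f∈ with ∈-++⁻ (map (2 ∷_) (frames m)) f∈
... | inj₁ f∈lifts = inj₁ (∈-map⁻ (2 ∷_) f∈lifts)
... | inj₂ f∈bumps = inj₂ (∈-map⁻ bump f∈bumps)

frames-head : ∀ m {f} → f ∈ frames m → 2 ≤ head f
frames-head zero    (here refl) = ≤-refl
frames-head (suc m) f∈ with ∈-frames⁻ f∈
... | inj₁ (g , _ , refl)  = ≤-refl
... | inj₂ (g , g∈ , refl) = subst (2 ≤_) (sym (head-bump g)) (m≤n⇒m≤1+n (frames-head m g∈))

frames-unique : ∀ m → Unique (frames m)
frames-unique zero    = [] ∷ []
frames-unique (suc m) =
  ++⁺ (map⁺ ∷-injectiveʳ (frames-unique m)) (map⁺ bump-injective (frames-unique m))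
      lifts∩bumps=∅
  where
  -- lifted frames have i₀ = 2, bumped ones i₀ ≥ 3
  lifts∩bumps=∅ : Disjoint (map (2 ∷_) (frames m)) (map bump (frames m))
  lifts∩bumps=∅ (f∈lifts , f∈bumps) with ∈-map⁻ (2 ∷_) f∈lifts | ∈-map⁻ bump f∈bumps
  ... | _ , _ , refl | g , g∈ , eq = <-irrefl refl (begin-strict
    2                ≤⟨ frames-head m g∈ ⟩
    head g           <⟨ n<1+n (head g) ⟩
    suc (head g)     ≡⟨ sym (head-bump g) ⟩
    head (bump g)    ≡⟨ cong head (sym eq) ⟩
    2                ∎)
    where open ≤-Reasoning

frames-length : ∀ m → length (frames m) ≡ 2 ^ m
frames-length zero    = refl
frames-length (suc m) = begin
  length (map (2 ∷_) (frames m) ++ map bump (frames m))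
    ≡⟨ length-++ (map (2 ∷_) (frames m)) ⟩
  length (map (2 ∷_) (frames m)) + length (map bump (frames m))
    ≡⟨ cong₂ _+_ (length-map (2 ∷_) (frames m)) (length-map bump (frames m)) ⟩
  length (frames m) + length (frames m)
    ≡⟨ cong₂ _+_ (frames-length m) (frames-length m) ⟩
  2 ^ m + 2 ^ m
    ≡⟨ cong (2 ^ m +_) (sym (+-identityʳ (2 ^ m))) ⟩
  2 ^ suc m ∎
  where open ≡-Reasoning

lift-frame : ∀ {n f} → IsFrame n f → IsFrame (suc n) (2 ∷ f)
lift-frame {n} (t , dyck@(_ , d) , refl) = U ∷ t ++ D ∷ [] , lift-dyck {n} dyck , frame-lift n d

bump-frame : ∀ {n f} → IsFrame n f → IsFrame (suc n) (bump f)
bump-frame {n} (t , dyck , refl) =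
  U ∷ D ∷ t , peak-dyck {n} dyck , frame-bump {n} (U ∷ D ∷ t) dyck (vertsAt-peak t)

frames-sound : ∀ m {f} → f ∈ frames m → IsFrame (suc m) f
frames-sound zero    (here refl) = U ∷ D ∷ [] , (refl , up (down end)) , refl
frames-sound (suc m) f∈ with ∈-frames⁻ f∈
... | inj₁ (g , g∈ , refl) = lift-frame (frames-sound m g∈)
... | inj₂ (g , g∈ , refl) = bump-frame (frames-sound m g∈)

frames-complete : ∀ m {s} → IsDyckPath (suc m) s → frame (suc m) s ∈ frames m
frames-complete zero {[]}              (() , _)
frames-complete zero {_ ∷ []}          (() , _)
frames-complete zero {_ ∷ _ ∷ _ ∷ _}   (() , _)
frames-complete zero {_ ∷ _ ∷ []}      (_ , up (down end)) = here refl
frames-complete (suc m) {U ∷ s} (len , up d) with first-return d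
... | lifted {p} dp =
  subst (_∈ frames (suc m)) (sym (frame-lift (suc m) dp))
    (∈-++⁺ˡ (∈-map⁺ (2 ∷_) (frames-complete m dyck-p)))
  where
  dyck-p : IsDyckPath (suc m) p
  dyck-p = semilength-down (suc m) (trans (sym (length-lift p)) len) , dp
... | continued {p} {r} {q} dp dr dq =
  subst (_∈ frames (suc m))
    (sym (frame-bump {suc m} (U ∷ p ++ D ∷ U ∷ r ++ D ∷ q) dyck-t (vertsAt-merge r q dp)))
    (∈-++⁺ʳ (map (2 ∷_) (frames m)) (∈-map⁺ bump (frames-complete m dyck-t)))
  where
  dyck-t : IsDyckPath (suc m) (U ∷ p ++ r ++ D ∷ q)
  dyck-t = semilength-down (suc m) (trans (sym (length-merge p r q)) len) ,
           up (dyck-++ dp (dyck-++ dr (down dq)))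

mainTheorem6 : (n : ℕ) → 0 < n →
    ∃ λ (L : List (Vec ℕ (suc n))) →
    Unique L × (∀ f → (f ∈ L) ⇔ IsFrame n f) × (length L ≡ 2 ^ (n ∸ 1))
mainTheorem6 (suc m) _ =
  frames m ,
  frames-unique m ,
  (λ f → mk⇔ (frames-sound m) λ { (s , dyck , refl) → frames-complete m dyck }) ,
  frames-length m
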